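{- Let $G$ be a graph and let the vertices $v_1,\dots,v_6$ of $G$ build an $AP_6$. Assume that no two of the three edges $v_2v_3$, $v_4v_5$, $v_6v_1$ are in conflict. Then $v_3v_6$, $v_4v_1$, $v_5v_2$ are edges of $G$, and $v_4v_5\,\|\,v_3v_6$, $v_2v_3\,\|\,v_4v_1$, and $v_6v_1\,\|\,v_5v_2$.
   Context: Six distinct vertices $v_1,\dots,v_6$ of $G$ build an $AP_6$ (alternating path of length 6) if $v_2v_3,v_4v_5,v_6v_1$ are edges and $v_1v_2,v_3v_4,v_5v_6$ are non-edges of $G$. Two edges $e_1,e_2$ of $G$ are in conflict, written $e_1\|e_2$, if one can write $e_1=ab$, $e_2=cd$ with $a,b,c,d$ distinct and $ad$, $bc$ non-edges of $G$. -}

module Defs where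

open import Data.Nat using (ℕ)
open import Data.Fin using (Fin)
open import Data.Bool using (Bool; true; false)
open import Data.Product using (_×_; ∃-syntax)
open import Data.Sum using (_⊎_)
open import Relation.Binary.PropositionalEquality using (_≡_; _≢_)

record Graph (n : ℕ) : Set where
  field
    adj     : Fin n → Fin n → Bool
    adj-sym : ∀ u v → adj u v ≡ adj v u
    adj-irr : ∀ v → adj v v ≡ false

open Graph public

module _ {n : ℕ} (G : Graph n) where

  Edge : Fin n → Fin n → Set
  Edge u v = adj G u v ≡ true

  NonEdge : Fin n → Fin n → Set
  NonEdge u v = adj G u v ≡ false

  Distinct4 : Fin n → Fin n → Fin n → Fin n → Set
  Distinct4 a b c d =
    a ≢ b × a ≢ c × a ≢ d × b ≢ c × b ≢ d × c ≢ d

  Distinct6 : Fin n → Fin n → Fin n → Fin n → Fin n → Fin n → Set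
  Distinct6 v₁ v₂ v₃ v₄ v₅ v₆ =
    v₁ ≢ v₂ × v₁ ≢ v₃ × v₁ ≢ v₄ × v₁ ≢ v₅ × v₁ ≢ v₆ ×
    v₂ ≢ v₃ × v₂ ≢ v₄ × v₂ ≢ v₅ × v₂ ≢ v₆ ×
    v₃ ≢ v₄ × v₃ ≢ v₅ × v₃ ≢ v₆ ×
    v₄ ≢ v₅ × v₄ ≢ v₆ ×
    v₅ ≢ v₆

  AP6 : Fin n → Fin n → Fin n → Fin n → Fin n → Fin n → Set
  AP6 v₁ v₂ v₃ v₄ v₅ v₆ =
    Distinct6 v₁ v₂ v₃ v₄ v₅ v₆ ×
    Edge v₂ v₃ × Edge v₄ v₅ × Edge v₆ v₁ ×
    NonEdge v₁ v₂ × NonEdge v₃ v₄ × NonEdge v₅ v₆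

  -- Conflict of two edges e₁ = {x,y}, e₂ = {z,w} (both assumed to be edges):
  -- e₁ ∥ e₂ iff one can write e₁ = ab, e₂ = cd with a,b,c,d distinct and
  -- ad, bc non-edges.  The ways to write an unordered edge are the two
  -- orientations of each.
  ConflictOriented : Fin n → Fin n → Fin n → Fin n → Set
  ConflictOriented a b c d = Distinct4 a b c d × NonEdge a d × NonEdge b c

  Conflict : Fin n → Fin n → Fin n → Fin n → Set
  Conflict x y z w =
    Edge x y × Edge z w ×
    (ConflictOriented x y z w ⊎ ConflictOriented y x z w ⊎
     ConflictOriented x y w z ⊎ ConflictOriented y x w z)

-- The AP₆ is invariant under the rotation vᵢ ↦ vᵢ₊₂, which permutes the three
-- edges and the three hypotheses cyclically.  So it suffices to treat one pair:
-- the edges v₂v₃ and v₄v₅ are joined by the non-edge v₃v₄, hence they are in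
-- conflict unless v₂v₅ is an edge; and once v₃v₆ is an edge, the non-edges
-- v₃v₄ and v₅v₆ put v₄v₅ and v₃v₆ in conflict.
module Submission where

open import Defs
open import Data.Nat using (ℕ)
open import Data.Fin using (Fin)
open import Data.Bool.Properties using (¬-not)
open import Data.Product using (_×_; _,_)
open import Data.Sum using (_⊎_; inj₁; inj₂)
open import Function using (_∘_)
open import Relation.Nullary using (¬_)
open import Relation.Binary.PropositionalEquality using (trans; ≢-sym)

module _ {n : ℕ} (G : Graph n) where

  Edge-sym : ∀ {u v} → Edge G u v → Edge G v u
  Edge-sym {u} {v} = trans (adj-sym G v u)

  NonEdge-sym : ∀ {u v} → NonEdge G u v → NonEdge G v u
  NonEdge-sym {u} {v} = trans (adj-sym G v u)

  ¬NonEdge⇒Edge : ∀ {u v} → ¬ NonEdge G u v → Edge G u v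
  ¬NonEdge⇒Edge = ¬-not

  Orientations : Fin n → Fin n → Fin n → Fin n → Set
  Orientations x y z w =
    ConflictOriented G x y z w ⊎ ConflictOriented G y x z w ⊎
    ConflictOriented G x y w z ⊎ ConflictOriented G y x w z

  ConflictOriented-sym : ∀ {a b c d} →
                         ConflictOriented G a b c d → ConflictOriented G c d a b
  ConflictOriented-sym ((ab , ac , ad , bc , bd , cd) , ¬ad , ¬bc) =
    (cd , ≢-sym ac , ≢-sym bc , ≢-sym ad , ≢-sym bd , ab) ,
    NonEdge-sym ¬bc , NonEdge-sym ¬ad

  Orientations-sym : ∀ {x y z w} → Orientations x y z w → Orientations z w x y
  Orientations-sym (inj₁ o)               = inj₁ (ConflictOriented-sym o)
  Orientations-sym (inj₂ (inj₁ o))        = inj₂ (inj₂ (inj₁ (ConflictOriented-sym o)))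
  Orientations-sym (inj₂ (inj₂ (inj₁ o))) = inj₂ (inj₁ (ConflictOriented-sym o))
  Orientations-sym (inj₂ (inj₂ (inj₂ o))) = inj₂ (inj₂ (inj₂ (ConflictOriented-sym o)))

  Orientations-swapʳ : ∀ {x y z w} → Orientations x y z w → Orientations x y w z
  Orientations-swapʳ (inj₁ o)               = inj₂ (inj₂ (inj₁ o))
  Orientations-swapʳ (inj₂ (inj₁ o))        = inj₂ (inj₂ (inj₂ o))
  Orientations-swapʳ (inj₂ (inj₂ (inj₁ o))) = inj₁ o
  Orientations-swapʳ (inj₂ (inj₂ (inj₂ o))) = inj₂ (inj₁ o)

  Conflict-sym : ∀ {x y z w} → Conflict G x y z w → Conflict G z w x y
  Conflict-sym (exy , ezw , o) = ezw , exy , Orientations-sym o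

  Conflict-swapʳ : ∀ {x y z w} → Conflict G x y z w → Conflict G x y w z
  Conflict-swapʳ (exy , ezw , o) = exy , Edge-sym ezw , Orientations-swapʳ o

  ¬Conflict⇒Edge : ∀ {a b c d} → Edge G a b → Edge G c d → Distinct4 G a b c d →
                   NonEdge G b c → ¬ Conflict G a b c d → Edge G a d
  ¬Conflict⇒Edge eab ecd dist ¬bc noConflict =
    ¬NonEdge⇒Edge λ ¬ad → noConflict (eab , ecd , inj₁ (dist , ¬ad , ¬bc))

  AP6-rotate : ∀ {v₁ v₂ v₃ v₄ v₅ v₆} →
               AP6 G v₁ v₂ v₃ v₄ v₅ v₆ → AP6 G v₃ v₄ v₅ v₆ v₁ v₂
  AP6-rotate ((d12 , d13 , d14 , d15 , d16 , d23 , d24 , d25 , d26 ,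
               d34 , d35 , d36 , d45 , d46 , d56) ,
              e23 , e45 , e61 , ¬12 , ¬34 , ¬56) =
    (d34 , d35 , d36 , ≢-sym d13 , ≢-sym d23 ,
     d45 , d46 , ≢-sym d14 , ≢-sym d24 ,
     d56 , ≢-sym d15 , ≢-sym d25 ,
     ≢-sym d16 , ≢-sym d26 ,
     d12) ,
    e45 , e61 , e23 , ¬34 , ¬56 , ¬12

  AP6-chord : ∀ {v₁ v₂ v₃ v₄ v₅ v₆} → AP6 G v₁ v₂ v₃ v₄ v₅ v₆ →
              ¬ Conflict G v₂ v₃ v₄ v₅ → Edge G v₅ v₂
  AP6-chord ((_ , _ , _ , _ , _ , d23 , d24 , d25 , _ , d34 , d35 , _ , d45 , _ , _) ,
             e23 , e45 , _ , _ , ¬34 , _) noConflict =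
    Edge-sym (¬Conflict⇒Edge e23 e45 (d23 , d24 , d25 , d34 , d35 , d45) ¬34 noConflict)

  AP6-chord-conflict : ∀ {v₁ v₂ v₃ v₄ v₅ v₆} → AP6 G v₁ v₂ v₃ v₄ v₅ v₆ →
                       Edge G v₃ v₆ → Conflict G v₄ v₅ v₃ v₆
  AP6-chord-conflict ((_ , _ , _ , _ , _ , _ , _ , _ , _ , d34 , d35 , d36 , d45 , d46 , d56) ,
                      _ , e45 , _ , _ , ¬34 , ¬56) e36 =
    e45 , e36 ,
    inj₂ (inj₂ (inj₁ ((d45 , d46 , ≢-sym d34 , d56 , ≢-sym d35 , ≢-sym d36) ,
                      NonEdge-sym ¬34 , ¬56)))

lemma2 : ∀ {n} (G : Graph n) (v₁ v₂ v₃ v₄ v₅ v₆ : Fin n) →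
    AP6 G v₁ v₂ v₃ v₄ v₅ v₆ →
    ¬ Conflict G v₂ v₃ v₄ v₅ → ¬ Conflict G v₄ v₅ v₆ v₁ → ¬ Conflict G v₂ v₃ v₆ v₁ →
    (Edge G v₃ v₆ × Edge G v₄ v₁ × Edge G v₅ v₂) ×
    Conflict G v₄ v₅ v₃ v₆ × Conflict G v₂ v₃ v₄ v₁ × Conflict G v₆ v₁ v₅ v₂
lemma2 G v₁ v₂ v₃ v₄ v₅ v₆ ap ¬c₂₃₄₅ ¬c₄₅₆₁ ¬c₂₃₆₁ =
  (e₃₆ , Edge-sym G e₁₄ , e₅₂) ,
  AP6-chord-conflict G ap e₃₆ ,
  Conflict-swapʳ G (AP6-chord-conflict G ap₅ e₁₄) ,
  AP6-chord-conflict G ap₃ e₅₂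
  where
  ap₃ : AP6 G v₃ v₄ v₅ v₆ v₁ v₂
  ap₃ = AP6-rotate G ap
  ap₅ : AP6 G v₅ v₆ v₁ v₂ v₃ v₄
  ap₅ = AP6-rotate G ap₃
  e₅₂ : Edge G v₅ v₂
  e₅₂ = AP6-chord G ap ¬c₂₃₄₅
  e₁₄ : Edge G v₁ v₄
  e₁₄ = AP6-chord G ap₃ ¬c₄₅₆₁
  e₃₆ : Edge G v₃ v₆
  e₃₆ = AP6-chord G ap₅ (¬c₂₃₆₁ ∘ Conflict-sym G)
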